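{- The theory $T$ described below is pseudofinite (every finite subset of $T$, equivalently every sentence of $T$, holds in some finite structure).
   Context: $L$ has a unary predicate $U_\sigma$ for every $\sigma\in\omega^{<\omega}$ and a binary relation $B_{\sigma,\tau}$ for every pair $\sigma,\tau\in\omega^{<\omega}$ of the same length. $T$ consists of: (a) $U_\emptyset$ is the whole universe; (b) $U_\sigma \neq \emptyset$; (c) $U_\sigma \supset U_\tau$ whenever $\sigma$ is an initial segment of $\tau$; (d) $U_{\sigma i} \cap U_{\sigma j} = \emptyset$ for distinct numbers $i,j$; (e) $B_{\sigma,\tau}$ is the graph of a bijection from $U_\sigma$ to $U_\tau$; (f) $B_{\sigma,\tau}(x,y)\leftrightarrow B_{\tau,\sigma}(y,x)$; (g) $B_{\sigma,\tau}(x,y)\wedge B_{\tau,\rho}(y,z) \to B_{\sigma,\rho}(x,z)$; (h) if $U_{\sigma i}(x)$ and $U_\tau(y)$ then $B_{\sigma,\tau}(x,y)$ iff $U_{\tau i}(y)$ and $B_{\sigma i,\tau i}(x,y)$ (all strings indexing a $B$ having equal length). -}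

module Defs where

open import Data.Nat using (ℕ)
open import Data.Fin using (Fin)
open import Data.Vec using (Vec; _++_; _∷ʳ_)
open import Data.List using (List)
open import Data.List.Relation.Unary.All using (All)
open import Data.Product using (Σ; ∃; ∃-syntax; _×_)
open import Relation.Binary.PropositionalEquality using (_≡_; _≢_)
open import Relation.Nullary using (¬_)
open import Function.Bundles using (_⇔_)
open import Level using (0ℓ)

-- A string σ ∈ ω^{<ω} of length k is a  Vec ℕ k.
-- An L-structure whose universe is the finite set Fin n.
-- B is indexed only by pairs of strings of the same length, as in L.
record Structure (n : ℕ) : Set₁ where
  field
    U : ∀ {k} → Vec ℕ k → Fin n → Set
    B : ∀ {k} → Vec ℕ k → Vec ℕ k → Fin n → Fin n → Set

data Axiom : Set where
  axA : Axiom
  axB : ∀ {k} (σ : Vec ℕ k) → Axiom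
  -- τ = σ ++ ρ ranges over all extensions of σ
  axC : ∀ {k m} (σ : Vec ℕ k) (ρ : Vec ℕ m) → Axiom
  axD : ∀ {k} (σ : Vec ℕ k) (i j : ℕ) → i ≢ j → Axiom
  axE : ∀ {k} (σ τ : Vec ℕ k) → Axiom
  axF : ∀ {k} (σ τ : Vec ℕ k) → Axiom
  axG : ∀ {k} (σ τ ρ : Vec ℕ k) → Axiom
  axH : ∀ {k} (σ τ : Vec ℕ k) (i : ℕ) → Axiom

IsBijectionGraph : ∀ {n} (P Q : Fin n → Set) (R : Fin n → Fin n → Set) → Set
IsBijectionGraph P Q R =
  (∀ x y → R x y → P x × Q y) ×
  (∀ x → P x → ∃[ y ] R x y) ×
  (∀ x y y′ → R x y → R x y′ → y ≡ y′) ×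
  (∀ x x′ y → R x y → R x′ y → x ≡ x′) ×
  (∀ y → Q y → ∃[ x ] R x y)

Sat : ∀ {n} → Structure n → Axiom → Set
Sat {n} M axA = ∀ x → U Data.Vec.[] x
  where open Structure M
Sat M (axB σ) = ∃[ x ] U σ x
  where open Structure M
Sat M (axC σ ρ) = ∀ x → U (σ ++ ρ) x → U σ x
  where open Structure M
Sat M (axD σ i j _) = ∀ x → ¬ (U (σ ∷ʳ i) x × U (σ ∷ʳ j) x)
  where open Structure M
Sat M (axE σ τ) = IsBijectionGraph (U σ) (U τ) (B σ τ)
  where open Structure M
Sat M (axF σ τ) = ∀ x y → B σ τ x y ⇔ B τ σ y x
  where open Structure M
Sat M (axG σ τ ρ) = ∀ x y z → B σ τ x y → B τ ρ y z → B σ ρ x z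
  where open Structure M
Sat M (axH σ τ i) = ∀ x y → U (σ ∷ʳ i) x → U τ y →
                      (B σ τ x y ⇔ (U (τ ∷ʳ i) y × B (σ ∷ʳ i) (τ ∷ʳ i) x y))
  where open Structure M

Pseudofinite : Set₁
Pseudofinite = (Δ : List Axiom) → ∃[ n ] Σ (Structure n) (λ M → All (Sat M) Δ)

module Submission where

open import Defs
open import Data.Nat using (ℕ; zero; suc; _+_; _^_; _≤_; _<_; s≤s; NonZero)
open import Data.Nat.Properties
open import Data.Nat.DivMod using (_%_; _mod_; m<n⇒m%n≡m)
open import Data.Fin as Fin using (Fin; toℕ; fromℕ<; combine; finToFun; funToFin)
open import Data.Fin.Properties using (toℕ-fromℕ<; funToFin-finToFin; finToFun-funToFin)
open import Data.Vec using (Vec; []; _∷_; _++_; _∷ʳ_)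
open import Data.List using ([]; _∷_; map)
open import Data.Nat.ListAction using (sum)
open import Data.List.Relation.Unary.All using (All; []; _∷_)
open import Data.Product using (_×_; _,_; proj₁; proj₂; ∃-syntax)
open import Data.Sum using (inj₁; inj₂; [_,_])
open import Function using (_∘_; const)
open import Function.Bundles using (_⇔_; mk⇔)
open import Relation.Binary.PropositionalEquality using (_≡_; _≗_; refl; sym; trans; cong; cong₂; module ≡-Reasoning)
open import Relation.Nullary using (yes; no; contradiction)
open import Relation.Unary using (_⊆′_; _∪_)

-- The model M_N has as universe the functions x : {0, …, N-1} → {0, …, N};
-- U_σ consists of the x extending σ (entries read modulo N + 1, so that
-- U_σ is never empty), and B_{σ,τ} relates x ∈ U_σ and y ∈ U_τ iff x and y
-- agree from position |σ| on, i.e. y is x with its prefix σ overwritten by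
-- τ.  Axiom (h) is then the splitting of "agree from |σ|" into "agree at
-- |σ|" and "agree from |σ| + 1".  All axioms except (d) hold in every M_N,
-- and an instance of (d) holds as soon as N exceeds the length of σ and
-- the letters i and j; a finite set of axioms has finitely many such
-- instances, so some M_N satisfies all of it.

module _ {I A : Set} where

  AgreeOn : (I → Set) → (I → A) → (I → A) → Set
  AgreeOn P f g = ∀ p → P p → f p ≡ g p

  AgreeOn-sym : ∀ {P f g} → AgreeOn P f g → AgreeOn P g f
  AgreeOn-sym f≈g p p∈P = sym (f≈g p p∈P)

  AgreeOn-trans : ∀ {P f g h} → AgreeOn P f g → AgreeOn P g h → AgreeOn P f h
  AgreeOn-trans f≈g g≈h p p∈P = trans (f≈g p p∈P) (g≈h p p∈P)

  AgreeOn-⊆ : ∀ {P Q f g} → P ⊆′ Q → AgreeOn Q f g → AgreeOn P f g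
  AgreeOn-⊆ P⊆Q f≈g p p∈P = f≈g p (P⊆Q p p∈P)

  AgreeOn-∪ : ∀ {P Q f g} → AgreeOn P f g → AgreeOn Q f g → AgreeOn (P ∪ Q) f g
  AgreeOn-∪ f≈g f≈g′ p = [ f≈g p , f≈g′ p ]

module _ {N : ℕ} where

  Below From At : ℕ → Fin N → Set
  Below k p = toℕ p < k
  From  k p = k ≤ toℕ p
  At    k p = toℕ p ≡ k

  Below-mono : ∀ {k l} → k ≤ l → Below k ⊆′ Below l
  Below-mono k≤l _ p<k = <-≤-trans p<k k≤l

  Below-suc⊆ : ∀ {k} → Below (suc k) ⊆′ Below k ∪ At k
  Below-suc⊆ _ = m<1+n⇒m<n∨m≡n

  At⊆Below-suc : ∀ {k} → At k ⊆′ Below (suc k)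
  At⊆Below-suc _ p≡k = s≤s (≤-reflexive p≡k)

  At⊆From : ∀ {k} → At k ⊆′ From k
  At⊆From _ p≡k = ≤-reflexive (sym p≡k)

  From-suc⊆From : ∀ {k} → From (suc k) ⊆′ From k
  From-suc⊆From _ = <⇒≤

  From⊆ : ∀ {k} → From k ⊆′ At k ∪ From (suc k)
  From⊆ _ k≤p = [ inj₂ , inj₁ ∘ sym ] (m≤n⇒m<n∨m≡n k≤p)

  module _ {A : Set} where

    AgreeOn-Below-From⇒≗ : ∀ {k} {f g : Fin N → A} →
      AgreeOn (Below k) f g → AgreeOn (From k) f g → f ≗ g
    AgreeOn-Below-From⇒≗ {k} below from p = [ below p , from p ] (<-≤-connex (toℕ p) k)

    splice : ℕ → (Fin N → A) → (Fin N → A) → Fin N → A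
    splice k f g p with toℕ p <? k
    ... | yes _ = f p
    ... | no  _ = g p

    splice-Below : ∀ {k f g} → AgreeOn (Below k) (splice k f g) f
    splice-Below {k} p p<k with toℕ p <? k
    ... | yes _   = refl
    ... | no  p≮k = contradiction p<k p≮k

    splice-From : ∀ {k f g} → AgreeOn (From k) (splice k f g) g
    splice-From {k} p k≤p with toℕ p <? k
    ... | yes p<k = contradiction k≤p (<⇒≱ p<k)
    ... | no  _   = refl

-- The m-th entry of a string, with the junk value 0 past its end.
at : ∀ {k} → Vec ℕ k → ℕ → ℕ
at []      _       = 0
at (a ∷ σ) zero    = a
at (a ∷ σ) (suc m) = at σ m

at-++ : ∀ {k l} (σ : Vec ℕ k) (ρ : Vec ℕ l) {m} → m < k → at (σ ++ ρ) m ≡ at σ m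
at-++ (a ∷ σ) ρ {zero}  _         = refl
at-++ (a ∷ σ) ρ {suc m} (s≤s m<k) = at-++ σ ρ m<k

at-∷ʳ : ∀ {k} (σ : Vec ℕ k) i {m} → m < k → at (σ ∷ʳ i) m ≡ at σ m
at-∷ʳ (a ∷ σ) i {zero}  _         = refl
at-∷ʳ (a ∷ σ) i {suc m} (s≤s m<k) = at-∷ʳ σ i m<k

at-∷ʳ-last : ∀ {k} (σ : Vec ℕ k) i → at (σ ∷ʳ i) k ≡ i
at-∷ʳ-last []      i = refl
at-∷ʳ-last (a ∷ σ) i = at-∷ʳ-last σ i

mod-injective : ∀ {m i j} .{{_ : NonZero m}} → i < m → j < m → i mod m ≡ j mod m → i ≡ j
mod-injective {m} {i} {j} i<m j<m i≡j = begin
  i              ≡⟨ m<n⇒m%n≡m i<m ⟨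
  i % m          ≡⟨ toℕ-fromℕ< _ ⟨
  toℕ (i mod m)  ≡⟨ cong toℕ i≡j ⟩
  toℕ (j mod m)  ≡⟨ toℕ-fromℕ< _ ⟩
  j % m          ≡⟨ m<n⇒m%n≡m j<m ⟩
  j              ∎
  where open ≡-Reasoning

funToFin-cong : ∀ {m n} {f g : Fin m → Fin n} → f ≗ g → funToFin f ≡ funToFin g
funToFin-cong {zero}  f≗g = refl
funToFin-cong {suc m} f≗g = cong₂ combine (f≗g Fin.zero) (funToFin-cong (f≗g ∘ Fin.suc))

finToFun-injective : ∀ {m n} {x y : Fin (m ^ n)} → finToFun {m} {n} x ≗ finToFun y → x ≡ y
finToFun-injective {m} {n} {x} {y} x≗y = begin
  x                               ≡⟨ funToFin-finToFin {n} {m} x ⟨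
  funToFin (finToFun {m} {n} x)   ≡⟨ funToFin-cong {n} {m} x≗y ⟩
  funToFin (finToFun {m} {n} y)   ≡⟨ funToFin-finToFin {n} {m} y ⟩
  y                               ∎
  where open ≡-Reasoning

weight : Axiom → ℕ
weight (axD {k} _ i j _) = k + i + j
weight _                 = 0

module Model (N : ℕ) where

  Point : Set
  Point = Fin (suc N ^ N)

  coords : Point → Fin N → Fin (suc N)
  coords = finToFun

  point : (Fin N → Fin (suc N)) → Point
  point = funToFin

  coords-point : ∀ f p → coords (point f) p ≡ f p
  coords-point = finToFun-funToFin

  word : ∀ {k} → Vec ℕ k → Fin N → Fin (suc N)
  word σ p = at σ (toℕ p) mod suc N

  word-++ : ∀ {k l} (σ : Vec ℕ k) (ρ : Vec ℕ l) → AgreeOn (Below k) (word (σ ++ ρ)) (word σ)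
  word-++ σ ρ _ p<k = cong (_mod suc N) (at-++ σ ρ p<k)

  word-∷ʳ : ∀ {k} (σ : Vec ℕ k) i → AgreeOn (Below k) (word (σ ∷ʳ i)) (word σ)
  word-∷ʳ σ i _ p<k = cong (_mod suc N) (at-∷ʳ σ i p<k)

  word-∷ʳ-last : ∀ {k} (σ : Vec ℕ k) i → AgreeOn (At k) (word (σ ∷ʳ i)) (const (i mod suc N))
  word-∷ʳ-last σ i _ p≡k = cong (_mod suc N) (trans (cong (at (σ ∷ʳ i)) p≡k) (at-∷ʳ-last σ i))

  U : ∀ {k} → Vec ℕ k → Point → Set
  U {k} σ x = AgreeOn (Below k) (coords x) (word σ)

  B : ∀ {k} → Vec ℕ k → Vec ℕ k → Point → Point → Set
  B {k} σ τ x y = U σ x × U τ y × AgreeOn (From k) (coords x) (coords y)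

  structure : Structure (suc N ^ N)
  structure = record { U = U ; B = B }

  LetterAt : ℕ → ℕ → Point → Set
  LetterAt k i x = AgreeOn (At k) (coords x) (const (i mod suc N))

  U-∷ʳ⁻ : ∀ {k} (σ : Vec ℕ k) i {x} → U (σ ∷ʳ i) x → U σ x × LetterAt k i x
  U-∷ʳ⁻ σ i x∈U =
      AgreeOn-trans (AgreeOn-⊆ (Below-mono (n≤1+n _)) x∈U) (word-∷ʳ σ i)
    , AgreeOn-trans (AgreeOn-⊆ At⊆Below-suc x∈U) (word-∷ʳ-last σ i)

  U-∷ʳ⁺ : ∀ {k} (σ : Vec ℕ k) i {x} → U σ x → LetterAt k i x → U (σ ∷ʳ i) x
  U-∷ʳ⁺ σ i x∈U x[k]≡i = AgreeOn-⊆ Below-suc⊆ (AgreeOn-∪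
    (AgreeOn-trans x∈U (AgreeOn-sym (word-∷ʳ σ i)))
    (AgreeOn-trans x[k]≡i (AgreeOn-sym (word-∷ʳ-last σ i))))

  U-nonempty : ∀ {k} (σ : Vec ℕ k) → ∃[ x ] U σ x
  U-nonempty σ = point (word σ) , λ p _ → coords-point (word σ) p

  U-++ : ∀ {k m} (σ : Vec ℕ k) (ρ : Vec ℕ m) {x} → U (σ ++ ρ) x → U σ x
  U-++ {k} {m} σ ρ x∈U = AgreeOn-trans (AgreeOn-⊆ (Below-mono (m≤m+n k m)) x∈U) (word-++ σ ρ)

  U-∷ʳ-disjoint : ∀ {k} (σ : Vec ℕ k) {i j x} → k < N → i ≤ N → j ≤ N →
    U (σ ∷ʳ i) x → U (σ ∷ʳ j) x → i ≡ j
  U-∷ʳ-disjoint σ {i} {j} k<N i≤N j≤N xi∈U xj∈U =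
    mod-injective (s≤s i≤N) (s≤s j≤N) (trans (sym (x[k]≡i p p≡k)) (x[k]≡j p p≡k))
    where
    p = fromℕ< k<N
    p≡k = toℕ-fromℕ< k<N
    x[k]≡i = proj₂ (U-∷ʳ⁻ σ i xi∈U)
    x[k]≡j = proj₂ (U-∷ʳ⁻ σ j xj∈U)

  U-unique : ∀ {k} (τ : Vec ℕ k) {y y′} →
    U τ y → U τ y′ → AgreeOn (From k) (coords y) (coords y′) → y ≡ y′
  U-unique τ y∈U y′∈U y≈y′ =
    finToFun-injective (AgreeOn-Below-From⇒≗ (AgreeOn-trans y∈U (AgreeOn-sym y′∈U)) y≈y′)

  overwrite : ∀ {k} → Vec ℕ k → Point → Point
  overwrite {k} τ x = point (splice k (word τ) (coords x))

  overwrite-B : ∀ {k} (σ τ : Vec ℕ k) {x} → U σ x → B σ τ x (overwrite τ x)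
  overwrite-B σ τ x∈U =
      x∈U
    , AgreeOn-trans (λ p _ → coords-point _ p) splice-Below
    , AgreeOn-sym (AgreeOn-trans (λ p _ → coords-point _ p) splice-From)

  B-sym : ∀ {k} (σ τ : Vec ℕ k) {x y} → B σ τ x y → B τ σ y x
  B-sym σ τ (x∈U , y∈U , x≈y) = y∈U , x∈U , AgreeOn-sym x≈y

  B-trans : ∀ {k} (σ τ ρ : Vec ℕ k) {x y z} → B σ τ x y → B τ ρ y z → B σ ρ x z
  B-trans σ τ ρ (x∈U , _ , x≈y) (_ , z∈U , y≈z) = x∈U , z∈U , AgreeOn-trans x≈y y≈z

  B-functional : ∀ {k} (σ τ : Vec ℕ k) {x y y′} → B σ τ x y → B σ τ x y′ → y ≡ y′
  B-functional σ τ (_ , y∈U , x≈y) (_ , y′∈U , x≈y′) =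
    U-unique τ y∈U y′∈U (AgreeOn-trans (AgreeOn-sym x≈y) x≈y′)

  B-isBijectionGraph : ∀ {k} (σ τ : Vec ℕ k) → IsBijectionGraph (U σ) (U τ) (B σ τ)
  B-isBijectionGraph σ τ =
      (λ _ _ (x∈U , y∈U , _) → x∈U , y∈U)
    , (λ x x∈U → overwrite τ x , overwrite-B σ τ x∈U)
    , (λ _ _ _ → B-functional σ τ)
    , (λ _ _ _ xBy x′By → B-functional τ σ (B-sym σ τ xBy) (B-sym σ τ x′By))
    , (λ y y∈U → overwrite σ y , B-sym τ σ (overwrite-B τ σ y∈U))

  B-∷ʳ : ∀ {k} (σ τ : Vec ℕ k) i {x y} → U (σ ∷ʳ i) x → U τ y →
    B σ τ x y ⇔ (U (τ ∷ʳ i) y × B (σ ∷ʳ i) (τ ∷ʳ i) x y)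
  B-∷ʳ σ τ i {x} {y} xi∈U y∈U = mk⇔ extend restrict
    where
    x∈U = proj₁ (U-∷ʳ⁻ σ i xi∈U)
    x[k]≡i = proj₂ (U-∷ʳ⁻ σ i xi∈U)
    extend : B σ τ x y → U (τ ∷ʳ i) y × B (σ ∷ʳ i) (τ ∷ʳ i) x y
    extend (_ , _ , x≈y) = yi∈U , xi∈U , yi∈U , AgreeOn-⊆ From-suc⊆From x≈y
      where
      yi∈U = U-∷ʳ⁺ τ i y∈U (AgreeOn-trans (AgreeOn-sym (AgreeOn-⊆ At⊆From x≈y)) x[k]≡i)
    restrict : U (τ ∷ʳ i) y × B (σ ∷ʳ i) (τ ∷ʳ i) x y → B σ τ x y
    restrict (yi∈U , _ , _ , x≈y) = x∈U , y∈U , AgreeOn-⊆ From⊆ (AgreeOn-∪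
      (AgreeOn-trans x[k]≡i (AgreeOn-sym y[k]≡i)) x≈y)
      where
      y[k]≡i = proj₂ (U-∷ʳ⁻ τ i yi∈U)

  satisfies : ∀ a → weight a < N → Sat structure a
  satisfies axA         _ _ _ ()
  satisfies (axB σ)     _ = U-nonempty σ
  satisfies (axC σ ρ)   _ _ = U-++ σ ρ
  satisfies (axD {k} σ i j i≢j) k+i+j<N _ (xi∈U , xj∈U) =
    i≢j (U-∷ʳ-disjoint σ (bound k≤k+i+j) (<⇒≤ (bound i≤k+i+j)) (<⇒≤ (bound j≤k+i+j)) xi∈U xj∈U)
    where
    bound : ∀ {m} → m ≤ k + i + j → m < N
    bound m≤ = ≤-<-trans m≤ k+i+j<N
    k≤k+i+j = ≤-trans (m≤m+n k i) (m≤m+n (k + i) j)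
    i≤k+i+j = ≤-trans (m≤n+m i k) (m≤m+n (k + i) j)
    j≤k+i+j = m≤n+m j (k + i)
  satisfies (axE σ τ)   _ = B-isBijectionGraph σ τ
  satisfies (axF σ τ)   _ _ _ = mk⇔ (B-sym σ τ) (B-sym τ σ)
  satisfies (axG σ τ ρ) _ _ _ _ = B-trans σ τ ρ
  satisfies (axH σ τ i) _ _ _ = B-∷ʳ σ τ i

satisfiesAll : ∀ {N} Δ → sum (map weight Δ) < N → All (Sat (Model.structure N)) Δ
satisfiesAll     []      _   = []
satisfiesAll {N} (a ∷ Δ) w<N =
  Model.satisfies N a (≤-<-trans (m≤m+n _ _) w<N) ∷ satisfiesAll Δ (≤-<-trans (m≤n+m _ _) w<N)

proposition3p4 : Pseudofinite
proposition3p4 Δ = _ , Model.structure N , satisfiesAll Δ (n<1+n _)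
  where N = suc (sum (map weight Δ))
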